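{- $c:=\inf_{\theta\in\mathbb{F}_q((1/t))}\ \sup_{\gamma\in\mathbb{F}_q((1/t))}\ \inf_{0\ne N\in\mathbb{F}_q[t]}|N|\cdot|\langle N\theta-\gamma\rangle|=q^{ -2}$.
   Context: $q$ is a prime power, $\mathbb{F}_q[t]$ the polynomial ring over $\mathbb{F}_q$, and $\mathbb{F}_q((1/t))$ the field of Laurent series $\theta=\sum_i\theta_it^{ -i}$ with finitely many nonzero coefficients of positive powers of $t$. Absolute value: $|\theta|=q^{\deg\theta}$ with $\deg\theta=\max\{ -i:\theta_i\ne0\}$, $|0|=0$. Fractional part: $\langle\theta\rangle=\sum_{i\ge1}\theta_it^{ -i}$. -}

module Defs where

open import Level using (Level; _⊔_)
open import Data.Nat using (ℕ; zero; suc)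
open import Data.Fin using (Fin; toℕ)
import Data.Fin
open import Data.Integer using (ℤ; +_; _<_; _≤_)
import Data.Integer as ℤ
open import Data.Product using (Σ; ∃; _×_; _,_)
open import Relation.Nullary using (¬_)
open import Relation.Binary.PropositionalEquality using (_≡_)
open import Algebra.Bundles using (CommutativeRing)

-- A finite field with q elements: a commutative ring with 1 ≠ 0 in which
-- every nonzero element is invertible, together with a bijective
-- enumeration  Fin q → Carrier  (bijective up to the ring's equality ≈).
-- (q = |F| is then automatically a prime power.)
record FiniteField (c ℓ : Level) : Set (Level.suc (c ⊔ ℓ)) where
  field
    cring : CommutativeRing c ℓ
  open CommutativeRing cring public hiding (ring)
  field
    1≉0     : ¬ (1# ≈ 0#)
    inverse : ∀ x → ¬ (x ≈ 0#) → Σ Carrier (λ y → x * y ≈ 1#)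
    q       : ℕ
    enum    : Fin q → Carrier
    enum-injective  : ∀ i j → enum i ≈ enum j → i ≡ j
    enum-surjective : ∀ x → Σ (Fin q) (λ i → enum i ≈ x)

module _ {c ℓ : Level} (F : FiniteField c ℓ) where
  open FiniteField F

  -- A Laurent series θ ∈ F((1/t)):  coeff j  is the coefficient of t^j
  -- (j ∈ ℤ); all coefficients of t^j with j > top vanish, so only finitely
  -- many positive powers of t occur.
  record Laurent : Set (c ⊔ ℓ) where
    field
      top     : ℤ
      coeff   : ℤ → Carrier
      vanish  : ∀ j → top < j → coeff j ≈ 0#
  open Laurent public

  record NonzeroPoly : Set (c ⊔ ℓ) where
    field
      deg     : ℕ
      pcoef   : Fin (suc deg) → Carrier
      leading : ¬ (pcoef (Data.Fin.fromℕ deg) ≈ 0#)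
  open NonzeroPoly public

  sumFin : (n : ℕ) → (Fin n → Carrier) → Carrier
  sumFin zero    f = 0#
  sumFin (suc n) f = f Data.Fin.zero + sumFin n (λ i → f (Data.Fin.suc i))

  coeffNθ-γ : NonzeroPoly → Laurent → Laurent → ℤ → Carrier
  coeffNθ-γ N θ γ j =
    sumFin (suc (deg N)) (λ k → pcoef N k * coeff θ (j ℤ.- + toℕ k)) - coeff γ j

  -- "|N| · |⟨N θ - γ⟩| ≤ q^e" :  deg N + deg ⟨Nθ-γ⟩ ≤ e, i.e. every
  -- coefficient of t^j of the fractional part ⟨Nθ-γ⟩ (j ≤ -1) with
  -- j > e - deg N vanishes (this includes the case ⟨Nθ-γ⟩ = 0).
  ValueLe : NonzeroPoly → Laurent → Laurent → ℤ → Set ℓ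
  ValueLe N θ γ e = ∀ j → e ℤ.- + deg N < j → j ≤ ℤ.- + 1 → coeffNθ-γ N θ γ j ≈ 0#

  -- "|N| · |⟨N θ - γ⟩| ≥ q^e" : some coefficient of t^j of ⟨Nθ-γ⟩ with
  -- e - deg N ≤ j ≤ -1 is nonzero.
  ValueGe : NonzeroPoly → Laurent → Laurent → ℤ → Set ℓ
  ValueGe N θ γ e = Σ ℤ (λ j → (e ℤ.- + deg N ≤ j) × (j ≤ ℤ.- + 1) × ¬ (coeffNθ-γ N θ γ j ≈ 0#))

{-# OPTIONS --safe #-}
module Submission where

-- Write a m for the coefficient of t^-(m+1) in θ. For deg N ≤ d the coefficients of t^-1, …, t^-(d+2)
-- in Nθ are the Hankel products Σ_k N_k a(m+k), m ≤ d+1, so the lower bound asks for a sequence γ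
-- that no N of degree ≤ d matches at m = 0, …, d+1, for any d. Choose γ greedily: whenever the
-- n×n Hankel matrix H_n = (a(i+j)) is nonsingular, exactly one Γ of degree < n matches γ below n,
-- and γ n is set to differ from its product at n. Suppose N of degree ≤ d matches γ up to d+1 and
-- let n ≤ d+1 be largest with H_n nonsingular. If n = d+1, this contradicts the choice of γ (d+1).
-- Otherwise take the monic Q of degree n killing the first n rows; it is a linear recurrence for a.
-- If the recurrence holds below d+1, reducing N - Γ by multiples of t^s Q shows that its product
-- at n vanishes, contradicting the choice of γ n; if it first fails at r ≤ d, then H_(r+1) is
-- nonsingular, contradicting the maximality of n.
-- For the upper bound take θ = t^-2 and N = γ₋₁ t + γ₋₂ (or N = 1 when γ₋₁ = 0).

open import Defs
open import Level using (Level; _⊔_)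
open import Data.Nat.Base
  using (ℕ; zero; suc; _∸_; _^_; _≤_; _<_; _≤′_; ≤′-refl; ≤′-step; z≤n; s≤s; s≤s⁻¹)
  renaming (_+_ to _+ₙ_)
import Data.Nat.Properties as ℕ
open import Data.Fin.Base using (Fin; zero; suc; toℕ; fromℕ<; funToFin; finToFun; combine; punchOut)
import Data.Fin.Properties as Fin
open import Data.Vec.Functional using (Vector)
open import Data.Integer.Base as ℤ using (ℤ; +_; -[1+_]; -≤-; -<-)
open import Data.Product.Base using (Σ; ∃; _×_; _,_; proj₁; proj₂)
open import Data.Sum.Base using (_⊎_; inj₁; inj₂; [_,_]′)
open import Data.Empty using (⊥-elim)
open import Function.Base using (_∘_)
open import Function.Definitions using (Injective)
open import Relation.Nullary using (¬_; Dec; yes; no)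
open import Relation.Nullary.Decidable using (map′; _→-dec_)
open import Relation.Unary using (Decidable)
open import Relation.Binary.PropositionalEquality as ≡ using (_≡_; _≢_; _≗_)
open import Algebra.Bundles using (CommutativeRing)
import Algebra.Properties.Ring as RingProperties
import Algebra.Properties.Semiring.Sum as SemiringSum

funToFin-cong : ∀ {m n} {f g : Fin m → Fin n} → f ≗ g → funToFin f ≡ funToFin g
funToFin-cong {zero}  _   = ≡.refl
funToFin-cong {suc m} f≗g = ≡.cong₂ combine (f≗g zero) (funToFin-cong (f≗g ∘ suc))

injective⇒surjective : ∀ {n} (f : Fin n → Fin n) → Injective _≡_ _≡_ f → ∀ y → ∃ λ x → f x ≡ y
injective⇒surjective {suc n} f f-injective y with Fin.any? (λ x → f x Fin.≟ y)
... | yes hit = hit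
... | no miss = ⊥-elim (Fin.<⇒notInjective ℕ.≤-refl g-injective)
  where
  y≢f : ∀ x → y ≢ f x
  y≢f x y≡fx = miss (x , ≡.sym y≡fx)

  g : Fin (suc n) → Fin n
  g x = punchOut (y≢f x)

  g-injective : Injective _≡_ _≡_ g
  g-injective {x} {z} gx≡gz = f-injective (Fin.punchOut-injective (y≢f x) (y≢f z) gx≡gz)

∀Fin⇒∀< : ∀ {p} {P : ℕ → Set p} {n} → (∀ (k : Fin n) → P (toℕ k)) → ∀ k → k < n → P k
∀Fin⇒∀< {P = P} h k k<n = ≡.subst P (Fin.toℕ-fromℕ< k<n) (h (fromℕ< k<n))

module _ {p} {P : ℕ → Set p} (P? : Decidable P) where

  least-counterexample : ∀ B → (∀ m → m < B → P m) ⊎ ∃ λ r → r < B × (∀ m → m < r → P m) × ¬ P r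
  least-counterexample zero = inj₁ (λ _ ())
  least-counterexample (suc B) with least-counterexample B
  ... | inj₂ (r , r<B , below , ¬Pr) = inj₂ (r , ℕ.m≤n⇒m≤1+n r<B , below , ¬Pr)
  ... | inj₁ below with P? B
  ...   | no ¬PB = inj₂ (B , ℕ.≤-refl , below , ¬PB)
  ...   | yes PB = inj₁ (λ m m<1+B →
                     [ below m , (λ m≡B → ≡.subst P (≡.sym m≡B) PB) ]′ (ℕ.m≤n⇒m<n∨m≡n (s≤s⁻¹ m<1+B)))

  greatest-satisfying : P 0 → ∀ B → ∃ λ n → n ≤ B × P n × (∀ m → n < m → m ≤ B → ¬ P m)
  greatest-satisfying P0 zero = 0 , z≤n , P0 , λ m 0<m m≤0 _ → ℕ.<⇒≱ 0<m m≤0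
  greatest-satisfying P0 (suc B) with P? (suc B)
  ... | yes P1+B = suc B , ℕ.≤-refl , P1+B , λ m 1+B<m m≤1+B _ → ℕ.<⇒≱ 1+B<m m≤1+B
  ... | no ¬P1+B with greatest-satisfying P0 B
  ...   | n , n≤B , Pn , above = n , ℕ.m≤n⇒m≤1+n n≤B , Pn , beyond
    where
    beyond : ∀ m → n < m → m ≤ suc B → ¬ P m
    beyond m n<m m≤1+B Pm =
      [ (λ m<1+B → above m n<m (s≤s⁻¹ m<1+B) Pm) , (λ m≡1+B → ¬P1+B (≡.subst P m≡1+B Pm)) ]′
      (ℕ.m≤n⇒m<n∨m≡n m≤1+B)

≤⇒∃+≡ : ∀ {m n} → m ≤ n → ∃ λ s → s +ₙ m ≡ n
≤⇒∃+≡ {m} {n} m≤n = n ∸ m , ℕ.m∸n+n≡m m≤n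

-[1+m]-n≡-[1+m+n] : ∀ m n → -[1+ m ] ℤ.- + n ≡ -[1+ m +ₙ n ]
-[1+m]-n≡-[1+m+n] m zero    = ≡.cong -[1+_] (≡.sym (ℕ.+-identityʳ m))
-[1+m]-n≡-[1+m+n] m (suc n) = ≡.cong -[1+_] (≡.sym (ℕ.+-suc m n))

module _ {c ℓ : Level} (F : FiniteField c ℓ) where
  open FiniteField F hiding (zero)
  open RingProperties (CommutativeRing.ring cring)
  open SemiringSum semiring
  open import Relation.Binary.Reasoning.Setoid setoid

  index : Carrier → Fin q
  index x = proj₁ (enum-surjective x)

  enum-index : ∀ x → enum (index x) ≈ x
  enum-index x = proj₂ (enum-surjective x)

  _≈?_ : (x y : Carrier) → Dec (x ≈ y)
  x ≈? y = map′ index-injective (λ x≈y → enum-injective _ _ (trans (enum-index x) (trans x≈y (sym (enum-index y)))))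
                (index x Fin.≟ index y)
    where
    index-injective : index x ≡ index y → x ≈ y
    index-injective e = trans (sym (enum-index x)) (trans (reflexive (≡.cong enum e)) (enum-index y))

  x*y≈0⇒x≈0 : ∀ {x y} → ¬ y ≈ 0# → x * y ≈ 0# → x ≈ 0#
  x*y≈0⇒x≈0 {x} {y} y≉0 xy≈0 with inverse y y≉0
  ... | y⁻¹ , yy⁻¹≈1 = begin
    x              ≈⟨ *-identityʳ x ⟨
    x * 1#         ≈⟨ *-congˡ yy⁻¹≈1 ⟨
    x * (y * y⁻¹)  ≈⟨ *-assoc x y y⁻¹ ⟨
    x * y * y⁻¹    ≈⟨ *-congʳ xy≈0 ⟩
    0# * y⁻¹       ≈⟨ zeroˡ y⁻¹ ⟩
    0#             ∎

  sumFin≡sum : ∀ n (f : Vector Carrier n) → sumFin F n f ≡ sum f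
  sumFin≡sum zero    f = ≡.refl
  sumFin≡sum (suc n) f = ≡.cong (λ s → f zero + s) (sumFin≡sum n (f ∘ suc))

  Poly : Set c
  Poly = ℕ → Carrier

  DegBelow : ℕ → Poly → Set ℓ
  DegBelow n N = ∀ k → n ≤ k → N k ≈ 0#

  fromVector : ∀ {n} → Vector Carrier n → Poly
  fromVector {n} v k with k ℕ.<? n
  ... | yes k<n = v (fromℕ< k<n)
  ... | no _    = 0#

  fromVector-< : ∀ {n} (v : Vector Carrier n) k (k<n : k < n) → fromVector v k ≈ v (fromℕ< k<n)
  fromVector-< {n} v k k<n with k ℕ.<? n
  ... | yes _   = refl
  ... | no k≮n = ⊥-elim (k≮n k<n)

  fromVector-toℕ : ∀ {n} (v : Vector Carrier n) i → fromVector v (toℕ i) ≈ v i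
  fromVector-toℕ v i = trans (fromVector-< v (toℕ i) (Fin.toℕ<n i)) (reflexive (≡.cong v (Fin.fromℕ<-toℕ i _)))

  fromVector-degBelow : ∀ {n} (v : Vector Carrier n) → DegBelow n (fromVector v)
  fromVector-degBelow {n} v k n≤k with k ℕ.<? n
  ... | yes k<n = ⊥-elim (ℕ.<⇒≱ k<n n≤k)
  ... | no _    = refl

  shift : ℕ → Poly → Poly
  shift zero    Q         = Q
  shift (suc s) Q zero    = 0#
  shift (suc s) Q (suc k) = shift s Q k

  shift-+ : ∀ s Q k → shift s Q (s +ₙ k) ≡ Q k
  shift-+ zero    Q k = ≡.refl
  shift-+ (suc s) Q k = shift-+ s Q k

  monomial : ℕ → Poly
  monomial n k with k ℕ.≟ n
  ... | yes _ = 1#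
  ... | no _  = 0#

  monomial-self : ∀ n → monomial n n ≈ 1#
  monomial-self n with n ℕ.≟ n
  ... | yes _   = refl
  ... | no n≢n = ⊥-elim (n≢n ≡.refl)

  encode : ∀ n → Poly → Fin (q ^ n)
  encode n N = funToFin (λ (k : Fin n) → index (N (toℕ k)))

  decode : ∀ n → Fin (q ^ n) → Poly
  decode n i = fromVector (enum ∘ finToFun {q} {n} i)

  decode-encode : ∀ n N k → k < n → decode n (encode n N) k ≈ N k
  decode-encode n N k k<n = begin
    decode n (encode n N) k                    ≈⟨ fromVector-< _ k k<n ⟩
    enum (finToFun (encode n N) (fromℕ< k<n))  ≡⟨ ≡.cong enum (Fin.finToFun-funToFin _ (fromℕ< k<n)) ⟩
    enum (index (N (toℕ (fromℕ< k<n))))        ≈⟨ enum-index _ ⟩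
    N (toℕ (fromℕ< k<n))                       ≡⟨ ≡.cong N (Fin.toℕ-fromℕ< k<n) ⟩
    N k                                        ∎

  encode-injective : ∀ n {N M} → encode n N ≡ encode n M → ∀ k → k < n → N k ≈ M k
  encode-injective n {N} {M} e k k<n = begin
    N k                      ≈⟨ decode-encode n N k k<n ⟨
    decode n (encode n N) k  ≡⟨ ≡.cong (λ i → decode n i k) e ⟩
    decode n (encode n M) k  ≈⟨ decode-encode n M k k<n ⟩
    M k                      ∎

  decode-injective : ∀ n {i j} → (∀ k → k < n → decode n i k ≈ decode n j k) → i ≡ j
  decode-injective n {i} {j} i≈j =
    ≡.trans (≡.sym (Fin.funToFin-finToFin {n} {q} i))
            (≡.trans (funToFin-cong pointwise) (Fin.funToFin-finToFin {n} {q} j))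
    where
    pointwise : finToFun {q} {n} i ≗ finToFun j
    pointwise k = enum-injective _ _ (begin
      enum (finToFun i k)  ≈⟨ fromVector-toℕ _ k ⟨
      decode n i (toℕ k)   ≈⟨ i≈j (toℕ k) (Fin.toℕ<n k) ⟩
      decode n j (toℕ k)   ≈⟨ fromVector-toℕ _ k ⟩
      enum (finToFun j k)  ∎)

  decode-degBelow : ∀ n i → DegBelow n (decode n i)
  decode-degBelow n i = fromVector-degBelow _

  -- For a m the coefficient of t^-(m+1) in θ and deg N < L, hankel L N m is the coefficient of
  -- t^-(m+1) in Nθ; only the fractional part of θ contributes.
  module Hankel (a : ℕ → Carrier) where

    hankel : ℕ → Poly → ℕ → Carrier
    hankel L N m = sum {L} λ k → N (toℕ k) * a (m +ₙ toℕ k)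

    hankel-cong : ∀ L {N M} m → (∀ k → k < L → N k ≈ M k) → hankel L N m ≈ hankel L M m
    hankel-cong L m N≈M = sum-cong-≋ {L} (λ k → *-congʳ (N≈M (toℕ k) (Fin.toℕ<n k)))

    hankel-zero : ∀ L N m → (∀ k → k < L → N k ≈ 0#) → hankel L N m ≈ 0#
    hankel-zero L N m N≈0 =
      trans (sum-cong-≋ {L} (λ k → trans (*-congʳ (N≈0 (toℕ k) (Fin.toℕ<n k))) (zeroˡ _))) (sum-replicate-zero L)

    hankel-suc : ∀ L N m → hankel (suc L) N m ≈ hankel L N m + N L * a (m +ₙ L)
    hankel-suc L N m = trans (sum-init-last {L} (term ∘ toℕ)) (+-cong
      (sum-cong-≋ {L} (λ k → reflexive (≡.cong term (Fin.toℕ-inject₁ k))))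
      (reflexive (≡.cong term (Fin.toℕ-fromℕ L))))
      where
      term : ℕ → Carrier
      term j = N j * a (m +ₙ j)

    hankel-pad : ∀ L N m → N L ≈ 0# → hankel (suc L) N m ≈ hankel L N m
    hankel-pad L N m NL≈0 = begin
      hankel (suc L) N m              ≈⟨ hankel-suc L N m ⟩
      hankel L N m + N L * a (m +ₙ L)  ≈⟨ +-congˡ (trans (*-congʳ NL≈0) (zeroˡ _)) ⟩
      hankel L N m + 0#               ≈⟨ +-identityʳ _ ⟩
      hankel L N m                    ∎

    hankel-extend : ∀ {L L′} N m → L ≤′ L′ → DegBelow L N → hankel L′ N m ≈ hankel L N m
    hankel-extend N m ≤′-refl          _      = refl
    hankel-extend N m (≤′-step L≤′L′) deg<L =
      trans (hankel-pad _ N m (deg<L _ (ℕ.≤′⇒≤ L≤′L′))) (hankel-extend N m L≤′L′ deg<L)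

    hankel-add : ∀ L N M m → hankel L (λ k → N k + M k) m ≈ hankel L N m + hankel L M m
    hankel-add L N M m = trans (sum-cong-≋ {L} (λ k → distribʳ _ (N (toℕ k)) (M (toℕ k)))) (∑-distrib-+ {L} _ _)

    hankel-scale : ∀ L x N m → hankel L (λ k → x * N k) m ≈ x * hankel L N m
    hankel-scale L x N m = trans (sum-cong-≋ {L} (λ k → *-assoc x (N (toℕ k)) _)) (sym (*-distribˡ-sum {L} x _))

    hankel-sub : ∀ L N M m → hankel L (λ k → N k - M k) m ≈ hankel L N m - hankel L M m
    hankel-sub L N M m = begin
      hankel L (λ k → N k - M k) m                  ≈⟨ hankel-cong L m negate≈ ⟨
      hankel L (λ k → N k + - 1# * M k) m           ≈⟨ hankel-add L N (λ k → - 1# * M k) m ⟩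
      hankel L N m + hankel L (λ k → - 1# * M k) m  ≈⟨ +-congˡ (hankel-scale L (- 1#) M m) ⟩
      hankel L N m + - 1# * hankel L M m            ≈⟨ +-congˡ (-1*x≈-x _) ⟩
      hankel L N m - hankel L M m                   ∎
      where
      negate≈ : ∀ k → k < L → N k + - 1# * M k ≈ N k - M k
      negate≈ k _ = +-congˡ (-1*x≈-x (M k))

    hankel-shift : ∀ s L Q m → hankel (s +ₙ L) (shift s Q) m ≈ hankel L Q (s +ₙ m)
    hankel-shift zero    L Q m = refl
    hankel-shift (suc s) L Q m = begin
      0# * a (m +ₙ 0) + rest               ≈⟨ +-congʳ (zeroˡ _) ⟩
      0# + rest                            ≈⟨ +-identityˡ _ ⟩
      rest                                 ≈⟨ sum-cong-≋ {s +ₙ L} rest-term≡ ⟩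
      hankel (s +ₙ L) (shift s Q) (suc m)  ≈⟨ hankel-shift s L Q (suc m) ⟩
      hankel L Q (s +ₙ suc m)              ≡⟨ ≡.cong (hankel L Q) (ℕ.+-suc s m) ⟩
      hankel L Q (suc s +ₙ m)              ∎
      where
      rest : Carrier
      rest = sum {s +ₙ L} λ k → shift s Q (toℕ k) * a (m +ₙ suc (toℕ k))

      rest-term≡ : ∀ k → shift s Q (toℕ k) * a (m +ₙ suc (toℕ k)) ≈ shift s Q (toℕ k) * a (suc m +ₙ toℕ k)
      rest-term≡ k = reflexive (≡.cong (λ j → shift s Q (toℕ k) * a j) (ℕ.+-suc m (toℕ k)))

    Nonsingular : ℕ → Set (c ⊔ ℓ)
    Nonsingular n = ∀ N → (∀ m → m < n → hankel n N m ≈ 0#) → ∀ k → k < n → N k ≈ 0#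

    nonsingular-zero : Nonsingular 0
    nonsingular-zero _ _ _ ()

    nonsingular-injective : ∀ {n} → Nonsingular n → ∀ {N M} →
      (∀ m → m < n → hankel n N m ≈ hankel n M m) → ∀ k → k < n → N k ≈ M k
    nonsingular-injective {n} ns {N} {M} same k k<n = x∙y⁻¹≈ε⇒x≈y _ _
      (ns (λ k → N k - M k) (λ m m<n → trans (hankel-sub n N M m) (x≈y⇒x∙y⁻¹≈ε (same m m<n))) k k<n)

    nonsingular? : ∀ n → Dec (Nonsingular n)
    nonsingular? n = map′ fromEnumeration toEnumeration (Fin.all? λ i →
      Fin.all? (λ k → hankel n (decode n i) (toℕ k) ≈? 0#) →-dec Fin.all? (λ k → decode n i (toℕ k) ≈? 0#))
      where
      NonsingularOnCodes : Set ℓ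
      NonsingularOnCodes = ∀ i → (∀ (k : Fin n) → hankel n (decode n i) (toℕ k) ≈ 0#) →
                                  ∀ (k : Fin n) → decode n i (toℕ k) ≈ 0#

      fromEnumeration : NonsingularOnCodes → Nonsingular n
      fromEnumeration h N N-kernel k k<n = begin
        N k                      ≈⟨ decode-encode n N k k<n ⟨
        decode n (encode n N) k  ≈⟨ ∀Fin⇒∀< {P = λ j → decode n (encode n N) j ≈ 0#} (h _ code-kernel) k k<n ⟩
        0#                       ∎
        where
        code-kernel : ∀ (j : Fin n) → hankel n (decode n (encode n N)) (toℕ j) ≈ 0#
        code-kernel j = trans (hankel-cong n (toℕ j) (decode-encode n N)) (N-kernel (toℕ j) (Fin.toℕ<n j))

      toEnumeration : Nonsingular n → NonsingularOnCodes
      toEnumeration ns i kernel k =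
        ns (decode n i) (∀Fin⇒∀< {P = λ j → hankel n (decode n i) j ≈ 0#} kernel) (toℕ k) (Fin.toℕ<n k)

    nonsingular⇒surjective : ∀ {n} → Nonsingular n → ∀ v →
      ∃ λ Γ → DegBelow n Γ × (∀ m → m < n → hankel n Γ m ≈ v m)
    nonsingular⇒surjective {n} ns v =
      let i , φi≡v = injective⇒surjective φ φ-injective (encode n v)
      in  decode n i , decode-degBelow n i , encode-injective n φi≡v
      where
      φ : Fin (q ^ n) → Fin (q ^ n)
      φ i = encode n (hankel n (decode n i))

      φ-injective : Injective _≡_ _≡_ φ
      φ-injective e = decode-injective n (nonsingular-injective ns (encode-injective n e))

    next : ℕ → Poly → Carrier
    next n v with nonsingular? n
    ... | yes ns = hankel n (proj₁ (nonsingular⇒surjective ns v)) n + 1#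
    ... | no _   = 0#

    next-spec : ∀ {n} → Nonsingular n → ∀ v → ∃ λ Γ →
      DegBelow n Γ × (∀ m → m < n → hankel n Γ m ≈ v m) × next n v ≈ hankel n Γ n + 1#
    next-spec {n} ns v with nonsingular? n
    ... | yes ns′ = let Γ , deg<n , solves = nonsingular⇒surjective ns′ v in Γ , deg<n , solves , refl
    ... | no ¬ns  = ⊥-elim (¬ns ns)

    -- γ-upto n agrees with γ below n; it makes the course-of-values recursion structural.
    γ-upto : ℕ → Poly
    γ-upto zero    _ = 0#
    γ-upto (suc n) k with k ℕ.≟ n
    ... | yes _ = next n (γ-upto n)
    ... | no _  = γ-upto n k

    γ : Poly
    γ m = γ-upto (suc m) m

    γ-next : ∀ n → γ n ≡ next n (γ-upto n)
    γ-next n with n ℕ.≟ n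
    ... | yes _   = ≡.refl
    ... | no n≢n = ⊥-elim (n≢n ≡.refl)

    γ-upto-< : ∀ n k → k < n → γ-upto n k ≡ γ k
    γ-upto-< (suc n) k k<1+n with k ℕ.≟ n
    ... | yes ≡.refl = ≡.sym (γ-next k)
    ... | no k≢n     = γ-upto-< n k (ℕ.≤∧≢⇒< (s≤s⁻¹ k<1+n) k≢n)

    γ-spec : ∀ {n} → Nonsingular n → ∃ λ Γ →
      DegBelow n Γ × (∀ m → m < n → hankel n Γ m ≈ γ m) × γ n ≈ hankel n Γ n + 1#
    γ-spec {n} ns =
      let Γ , deg<n , solves , next≈ = next-spec ns (γ-upto n)
      in  Γ , deg<n , (λ m m<n → trans (solves m m<n) (reflexive (γ-upto-< n m m<n))) ,
          trans (reflexive (γ-next n)) next≈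

    nonsingular-mismatch : ∀ {L} → Nonsingular L → ∀ N →
      (∀ m → m < L → hankel L N m ≈ γ m) → ¬ hankel L N L ≈ γ L
    nonsingular-mismatch {L} ns N matches hit with γ-spec ns
    ... | Γ , _ , solves , γL≈ = 1≉0 (+-identityʳ-unique _ _ (sym (begin
      hankel L Γ L       ≈⟨ hankel-cong L L N≈Γ ⟨
      hankel L N L       ≈⟨ hit ⟩
      γ L                ≈⟨ γL≈ ⟩
      hankel L Γ L + 1#  ∎)))
      where
      N≈Γ : ∀ k → k < L → N k ≈ Γ k
      N≈Γ = nonsingular-injective ns (λ m m<L → trans (matches m m<L) (sym (solves m m<L)))

    monic-kernel : ∀ {n} → Nonsingular n → ∃ λ Q → Q n ≈ 1# × (∀ m → m < n → hankel (suc n) Q m ≈ 0#)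
    monic-kernel {n} ns with nonsingular⇒surjective ns (hankel (suc n) (monomial n))
    ... | R , deg<n , solves = (λ k → monomial n k - R k) , monic , kernel
      where
      monic : monomial n n - R n ≈ 1#
      monic = trans (+-cong (monomial-self n) (trans (-‿cong (deg<n n ℕ.≤-refl)) -0#≈0#)) (+-identityʳ 1#)

      kernel : ∀ m → m < n → hankel (suc n) (λ k → monomial n k - R k) m ≈ 0#
      kernel m m<n = trans (hankel-sub (suc n) (monomial n) R m)
        (x≈y⇒x∙y⁻¹≈ε (sym (trans (hankel-pad n R m (deg<n n ℕ.≤-refl)) (solves m m<n))))

    module Recurrence {n} (ns : Nonsingular n) (Q : Poly) (Q-monic : Q n ≈ 1#)
                      (Q-kernel : ∀ m → m < n → hankel (suc n) Q m ≈ 0#) where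

      -- σ m ≈ 0 says that a satisfies the recurrence with characteristic polynomial Q at step m.
      σ : ℕ → Carrier
      σ = hankel (suc n) Q

      reduce : ℕ → Poly → Poly
      reduce s N k = N k - N (s +ₙ n) * shift s Q k

      reduce-top : ∀ s N → reduce s N (s +ₙ n) ≈ 0#
      reduce-top s N = x≈y⇒x∙y⁻¹≈ε (begin
        N (s +ₙ n)                       ≈⟨ *-identityʳ _ ⟨
        N (s +ₙ n) * 1#                  ≈⟨ *-congˡ Q-monic ⟨
        N (s +ₙ n) * Q n                 ≡⟨ ≡.cong (N (s +ₙ n) *_) (≡.sym (shift-+ s Q n)) ⟩
        N (s +ₙ n) * shift s Q (s +ₙ n)  ∎)

      hankel-reduce : ∀ s N m →
        hankel (suc (s +ₙ n)) N m ≈ hankel (s +ₙ n) (reduce s N) m + N (s +ₙ n) * σ (s +ₙ m)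
      hankel-reduce s N m = begin
        hankel (suc (s +ₙ n)) N m
          ≈⟨ hankel-cong (suc (s +ₙ n)) m split ⟨
        hankel (suc (s +ₙ n)) (λ k → reduce s N k + lead * shift s Q k) m
          ≈⟨ hankel-add (suc (s +ₙ n)) (reduce s N) (λ k → lead * shift s Q k) m ⟩
        hankel (suc (s +ₙ n)) (reduce s N) m + hankel (suc (s +ₙ n)) (λ k → lead * shift s Q k) m
          ≈⟨ +-cong (hankel-pad (s +ₙ n) (reduce s N) m (reduce-top s N))
                    (hankel-scale (suc (s +ₙ n)) lead (shift s Q) m) ⟩
        hankel (s +ₙ n) (reduce s N) m + lead * hankel (suc (s +ₙ n)) (shift s Q) m
          ≡⟨ ≡.cong (λ L → hankel (s +ₙ n) (reduce s N) m + lead * hankel L (shift s Q) m)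
                    (≡.sym (ℕ.+-suc s n)) ⟩
        hankel (s +ₙ n) (reduce s N) m + lead * hankel (s +ₙ suc n) (shift s Q) m
          ≈⟨ +-congˡ (*-congˡ (hankel-shift s (suc n) Q m)) ⟩
        hankel (s +ₙ n) (reduce s N) m + lead * σ (s +ₙ m)
          ∎
        where
        lead : Carrier
        lead = N (s +ₙ n)

        split : ∀ k → k < suc (s +ₙ n) → reduce s N k + lead * shift s Q k ≈ N k
        split k _ = //-rightDividesˡ (lead * shift s Q k) (N k)

      module _ {r} (σ<r≈0 : ∀ m → m < r → σ m ≈ 0#) where

        reduce-kernel : ∀ s N m → s +ₙ m < r →
          hankel (suc (s +ₙ n)) N m ≈ 0# → hankel (s +ₙ n) (reduce s N) m ≈ 0#
        reduce-kernel s N m s+m<r N-kernel = begin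
          hankel (s +ₙ n) (reduce s N) m                            ≈⟨ +-identityʳ _ ⟨
          hankel (s +ₙ n) (reduce s N) m + 0#                       ≈⟨ +-congˡ (trans (*-congˡ σ≈0) (zeroʳ _)) ⟨
          hankel (s +ₙ n) (reduce s N) m + N (s +ₙ n) * σ (s +ₙ m)  ≈⟨ hankel-reduce s N m ⟨
          hankel (suc (s +ₙ n)) N m                                 ≈⟨ N-kernel ⟩
          0#                                                        ∎
          where
          σ≈0 : σ (s +ₙ m) ≈ 0#
          σ≈0 = σ<r≈0 _ s+m<r

        annihilate : ∀ s N → s +ₙ n ≤ suc r → (∀ m → m < n → hankel (s +ₙ n) N m ≈ 0#) →
                     ∀ m → s +ₙ m ≤ r → hankel (s +ₙ n) N m ≈ 0#
        annihilate zero    N _         N-low m _       = hankel-zero n N m (ns N N-low)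
        annihilate (suc s) N 1+s+n≤1+r N-low m 1+s+m≤r = begin
          hankel (suc (s +ₙ n)) N m                                  ≈⟨ hankel-reduce s N m ⟩
          hankel (s +ₙ n) (reduce s N) m + N (s +ₙ n) * σ (s +ₙ m)   ≈⟨ +-cong reduced≈0 (*-congˡ σ≈0) ⟩
          0# + N (s +ₙ n) * 0#                                        ≈⟨ trans (+-identityˡ _) (zeroʳ _) ⟩
          0#                                                          ∎
          where
          s+n≤r : s +ₙ n ≤ r
          s+n≤r = s≤s⁻¹ 1+s+n≤1+r

          σ≈0 : σ (s +ₙ m) ≈ 0#
          σ≈0 = σ<r≈0 _ 1+s+m≤r

          reduced≈0 : hankel (s +ₙ n) (reduce s N) m ≈ 0#
          reduced≈0 = annihilate s (reduce s N) (ℕ.m≤n⇒m≤1+n s+n≤r)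
            (λ k k<n → reduce-kernel s N k (ℕ.<-≤-trans (ℕ.+-monoʳ-< s k<n) s+n≤r) (N-low k k<n))
            m (ℕ.<⇒≤ 1+s+m≤r)

        module _ (σr≉0 : ¬ σ r ≈ 0#) where

          n≤r : n ≤ r
          n≤r = ℕ.≮⇒≥ (λ r<n → σr≉0 (Q-kernel r r<n))

          leading-vanishes : ∀ s N → s +ₙ n ≤ r →
            (∀ m → m ≤ r → hankel (suc (s +ₙ n)) N m ≈ 0#) → N (s +ₙ n) ≈ 0#
          leading-vanishes s N s+n≤r N-kernel = x*y≈0⇒x≈0 σr≉0 (begin
            N (s +ₙ n) * σ r                                          ≡⟨ ≡.cong (λ j → _ * σ j) (≡.sym s+m₀≡r) ⟩
            N (s +ₙ n) * σ (s +ₙ m₀)                                  ≈⟨ +-identityˡ _ ⟨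
            0# + N (s +ₙ n) * σ (s +ₙ m₀)                             ≈⟨ +-congʳ reduced≈0 ⟨
            hankel (s +ₙ n) (reduce s N) m₀ + N (s +ₙ n) * σ (s +ₙ m₀) ≈⟨ hankel-reduce s N m₀ ⟨
            hankel (suc (s +ₙ n)) N m₀                                ≈⟨ N-kernel m₀ (ℕ.m∸n≤m r s) ⟩
            0#                                                        ∎)
            where
            m₀ : ℕ
            m₀ = r ∸ s

            s+m₀≡r : s +ₙ m₀ ≡ r
            s+m₀≡r = ℕ.m+[n∸m]≡n (ℕ.≤-trans (ℕ.m≤m+n s n) s+n≤r)

            reduced≈0 : hankel (s +ₙ n) (reduce s N) m₀ ≈ 0#
            reduced≈0 = annihilate s (reduce s N) (ℕ.m≤n⇒m≤1+n s+n≤r)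
              (λ k k<n → reduce-kernel s N k (ℕ.<-≤-trans (ℕ.+-monoʳ-< s k<n) s+n≤r) (N-low k k<n))
              m₀ (ℕ.≤-reflexive s+m₀≡r)
              where
              N-low : ∀ k → k < n → hankel (suc (s +ₙ n)) N k ≈ 0#
              N-low k k<n = N-kernel k (ℕ.<⇒≤ (ℕ.<-≤-trans k<n (ℕ.≤-trans (ℕ.m≤n+m n s) s+n≤r)))

          nonsingular-up-to : ∀ s N → s +ₙ n ≤ suc r → (∀ m → m ≤ r → hankel (s +ₙ n) N m ≈ 0#) →
                              ∀ k → k < s +ₙ n → N k ≈ 0#
          nonsingular-up-to zero    N _         N-kernel =
            ns N (λ m m<n → N-kernel m (ℕ.<⇒≤ (ℕ.<-≤-trans m<n n≤r)))
          nonsingular-up-to (suc s) N 1+s+n≤1+r N-kernel k k<1+s+n =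
            [ below-top , at-top ]′ (ℕ.m≤n⇒m<n∨m≡n (s≤s⁻¹ k<1+s+n))
            where
            N-top≈0 : N (s +ₙ n) ≈ 0#
            N-top≈0 = leading-vanishes s N (s≤s⁻¹ 1+s+n≤1+r) N-kernel

            below-top : k < s +ₙ n → N k ≈ 0#
            below-top = nonsingular-up-to s N (ℕ.m≤n⇒m≤1+n (s≤s⁻¹ 1+s+n≤1+r))
              (λ m m≤r → trans (sym (hankel-pad _ N m N-top≈0)) (N-kernel m m≤r)) k

            at-top : k ≡ s +ₙ n → N k ≈ 0#
            at-top k≡s+n = trans (reflexive (≡.cong N k≡s+n)) N-top≈0

          nonsingular-suc : Nonsingular (suc r)
          nonsingular-suc N N-kernel = ≡.subst (λ L → ∀ k → k < L → N k ≈ 0#) s+n≡1+r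
            (nonsingular-up-to s N (ℕ.≤-reflexive s+n≡1+r)
              (λ m m≤r → ≡.subst (λ L → hankel L N m ≈ 0#) (≡.sym s+n≡1+r) (N-kernel m (s≤s m≤r))))
            where
            s : ℕ
            s = suc r ∸ n

            s+n≡1+r : s +ₙ n ≡ suc r
            s+n≡1+r = ℕ.m∸n+n≡m (ℕ.m≤n⇒m≤1+n n≤r)

      recurrent-mismatch : ∀ L N → n < L → (∀ m → m < L → σ m ≈ 0#) →
        ¬ (∀ m → m ≤ n → hankel L N m ≈ γ m)
      recurrent-mismatch L N n<L σ<L≈0 matches with γ-spec ns | ≤⇒∃+≡ (ℕ.<⇒≤ n<L)
      ... | Γ , deg<n , solves , γn≈ | s , ≡.refl = 1≉0 (begin
        1#                                ≈⟨ xyx⁻¹≈y (hankel n Γ n) 1# ⟨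
        hankel n Γ n + 1# - hankel n Γ n  ≈⟨ +-congʳ γn≈ ⟨
        γ n - hankel n Γ n                ≈⟨ M≈ n ℕ.≤-refl ⟨
        hankel (s +ₙ n) M n               ≈⟨ annihilate σ<L≈0 s M (ℕ.n≤1+n _) M-low n ℕ.≤-refl ⟩
        0#                                ∎)
        where
        M : Poly
        M k = N k - Γ k

        M≈ : ∀ m → m ≤ n → hankel (s +ₙ n) M m ≈ γ m - hankel n Γ m
        M≈ m m≤n = trans (hankel-sub (s +ₙ n) N Γ m)
          (+-cong (matches m m≤n) (-‿cong (hankel-extend {n} {s +ₙ n} Γ m (ℕ.≤⇒≤′ (ℕ.m≤n+m n s)) deg<n)))

        M-low : ∀ m → m < n → hankel (s +ₙ n) M m ≈ 0#
        M-low m m<n = trans (M≈ m (ℕ.<⇒≤ m<n)) (x≈y⇒x∙y⁻¹≈ε (sym (solves m m<n)))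

      nonsingular-above : ∀ L N → n < L → (∀ m → m ≤ n → hankel L N m ≈ γ m) →
                          ∃ λ r → n < suc r × suc r ≤ L × Nonsingular (suc r)
      nonsingular-above L N n<L matches with least-counterexample (λ m → σ m ≈? 0#) L
      ... | inj₁ σ<L≈0                      = ⊥-elim (recurrent-mismatch L N n<L σ<L≈0 matches)
      ... | inj₂ (r , r<L , σ<r≈0 , σr≉0) = r , s≤s (n≤r σ<r≈0 σr≉0) , r<L , nonsingular-suc σ<r≈0 σr≉0

    γ-unmatched : ∀ L N → ¬ (∀ m → m ≤ L → hankel L N m ≈ γ m)
    γ-unmatched L N matches with greatest-satisfying nonsingular? nonsingular-zero L
    ... | n , n≤L , ns , maximal with ℕ.m≤n⇒m<n∨m≡n n≤L
    ...   | inj₂ ≡.refl = nonsingular-mismatch ns N (λ m m<n → matches m (ℕ.<⇒≤ m<n)) (matches n ℕ.≤-refl)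
    ...   | inj₁ n<L =
      let Q , Q-monic , Q-kernel = monic-kernel ns
          r , n<1+r , 1+r≤L , ns′ = Recurrence.nonsingular-above ns Q Q-monic Q-kernel L N n<L
                                      (λ m m≤n → matches m (ℕ.≤-trans m≤n n≤L))
      in  maximal (suc r) n<1+r 1+r≤L ns′

  fractional : Poly → Laurent F
  fractional g = record { top = -[1+ 0 ] ; coeff = coeff-g ; vanish = vanish-g }
    where
    coeff-g : ℤ → Carrier
    coeff-g (+ _)    = 0#
    coeff-g -[1+ m ] = g m

    vanish-g : ∀ j → -[1+ 0 ] ℤ.< j → coeff-g j ≈ 0#
    vanish-g (+ _)    _        = refl
    vanish-g -[1+ _ ] (-<- ())

  coeffNθ-γ-fractional : ∀ N θ g m → coeffNθ-γ F N θ (fractional g) -[1+ m ] ≈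
    Hankel.hankel (λ j → coeff θ -[1+ j ]) (suc (deg N)) (fromVector (pcoef N)) m - g m
  coeffNθ-γ-fractional N θ g m =
    +-congʳ (trans (reflexive (sumFin≡sum (suc (deg N)) term)) (sum-cong-≋ {suc (deg N)} term≈))
    where
    term : Fin (suc (deg N)) → Carrier
    term k = pcoef N k * coeff θ (-[1+ m ] ℤ.- + toℕ k)

    term≈ : ∀ k → term k ≈ fromVector (pcoef N) (toℕ k) * coeff θ -[1+ m +ₙ toℕ k ]
    term≈ k = *-cong (sym (fromVector-toℕ (pcoef N) k)) (reflexive (≡.cong (coeff θ) (-[1+m]-n≡-[1+m+n] m (toℕ k))))

  lower-bound : (θ : Laurent F) → Σ (Laurent F) λ γ′ → (N : NonzeroPoly F) → ValueGe F N θ γ′ (ℤ.- + 2)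
  lower-bound θ = fractional γ , separated
    where
    open Hankel (λ m → coeff θ -[1+ m ])

    separated : (N : NonzeroPoly F) → ValueGe F N θ (fractional γ) (ℤ.- + 2)
    separated N with least-counterexample (λ m → hankel (suc (deg N)) (fromVector (pcoef N)) m ≈? γ m)
                                          (suc (suc (deg N)))
    ... | inj₁ all-match =
      ⊥-elim (γ-unmatched (suc (deg N)) (fromVector (pcoef N)) (λ m m≤1+d → all-match m (s≤s m≤1+d)))
    ... | inj₂ (m , m<2+d , _ , mismatch) = -[1+ m ] , in-window , -≤- z≤n ,
      λ coeff≈0 → mismatch (x∙y⁻¹≈ε⇒x≈y _ _ (trans (sym (coeffNθ-γ-fractional N θ γ m)) coeff≈0))
      where
      in-window : ℤ.- + 2 ℤ.- + deg N ℤ.≤ -[1+ m ]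
      in-window = ≡.subst (ℤ._≤ -[1+ m ]) (≡.sym (-[1+m]-n≡-[1+m+n] 1 (deg N))) (-≤- (s≤s⁻¹ m<2+d))

  t⁻² : Laurent F
  t⁻² = record { top = + 0 ; coeff = coeff-t⁻² ; vanish = vanish-t⁻² }
    where
    coeff-t⁻² : ℤ → Carrier
    coeff-t⁻² -[1+ 1 ] = 1#
    coeff-t⁻² _        = 0#

    vanish-t⁻² : ∀ j → + 0 ℤ.< j → coeff-t⁻² j ≈ 0#
    vanish-t⁻² (+ _) _ = refl

  upper-bound : Σ (Laurent F) λ θ → (γ′ : Laurent F) → Σ (NonzeroPoly F) λ N → ValueLe F N θ γ′ (ℤ.- + 2)
  upper-bound = t⁻² , approximant
    where
    approximant : (g : Laurent F) → Σ (NonzeroPoly F) λ N → ValueLe F N t⁻² g (ℤ.- + 2)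
    approximant g with coeff g -[1+ 0 ] ≈? 0#
    ... | yes g₁≈0 = one , close
      where
      one : NonzeroPoly F
      one = record { deg = 0 ; pcoef = λ _ → 1# ; leading = 1≉0 }

      close : ValueLe F one t⁻² g (ℤ.- + 2)
      close (+ _)          _              ()
      close -[1+ 0 ]       _              _ = x≈y⇒x∙y⁻¹≈ε (trans (+-identityʳ _) (trans (zeroʳ 1#) (sym g₁≈0)))
      close -[1+ suc _ ]   (-<- (s≤s ())) _
    ... | no g₁≉0 = linear , close
      where
      g₁ g₂ : Carrier
      g₁ = coeff g -[1+ 0 ]
      g₂ = coeff g -[1+ 1 ]

      linear : NonzeroPoly F
      linear = record { deg = 1 ; pcoef = λ { zero → g₂ ; (suc _) → g₁ } ; leading = g₁≉0 }

      close : ValueLe F linear t⁻² g (ℤ.- + 2)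
      close (+ _)              _                    ()
      close -[1+ 0 ]           _                    _ = x≈y⇒x∙y⁻¹≈ε
        (trans (+-cong (zeroʳ g₂) (trans (+-identityʳ _) (*-identityʳ g₁))) (+-identityˡ g₁))
      close -[1+ 1 ]           _                    _ = x≈y⇒x∙y⁻¹≈ε
        (trans (+-cong (*-identityʳ g₂) (trans (+-identityʳ _) (zeroʳ g₁))) (+-identityʳ g₂))
      close -[1+ suc (suc _) ] (-<- (s≤s (s≤s ()))) _

open import Data.Integer using (-_)

theorem3p9 : {c ℓ : Level} (F : FiniteField c ℓ) →
    -- lower bound: for every θ, sup_γ inf over nonzero N of |N| |⟨Nθ-γ⟩| ≥ q^(-2)
    ((θ : Laurent F) → Σ (Laurent F) (λ γ → (N : NonzeroPoly F) → ValueGe F N θ γ (- + 2)))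
    ×
    -- upper bound: for some θ, sup_γ inf over nonzero N of |N| |⟨Nθ-γ⟩| ≤ q^(-2)
    Σ (Laurent F) (λ θ → (γ : Laurent F) → Σ (NonzeroPoly F) (λ N → ValueLe F N θ γ (- + 2)))
theorem3p9 F = lower-bound F , upper-bound F
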